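{- Every split of $K_6$ contains $W_6$ as a minor.
   Context: All graphs are simple. Let $v$ be a vertex of a $4$-connected graph $G$ and let $X,Y\subseteq N_G(v)$ with $X\cup Y=N_G(v)$ and $|X|,|Y|\ge 3$. Splitting $v$ produces the graph obtained from $G\setminus v$ by adding two new adjacent vertices $x$ and $y$, joining $x$ to all vertices of $X$ and $y$ to all vertices of $Y$ (so each new vertex has degree at least $4$); such a graph is called a split of $G$. A minor is a graph obtainable by edge deletions and edge contractions; $W_6$ is the wheel obtained by joining a new vertex to all vertices of a $6$-cycle. -}

module Defs where

open import Data.Nat using (ℕ; zero; suc; _≤_)
open import Data.Bool using (Bool; true; false; _∧_; _∨_; not)
open import Data.Bool.Properties using (∨-comm)
open import Data.Fin using (Fin; zero; suc; punchIn; toℕ; _≟_)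
open import Data.Fin.Subset using (Subset; _∪_; _⊆_; ∣_∣)
open import Data.Vec using (lookup; tabulate)
open import Data.Product using (Σ; ∃; _×_; _,_)
open import Data.Sum using (_⊎_)
open import Relation.Nullary using (¬_; yes; no; contradiction)
open import Relation.Nullary.Decidable using (⌊_⌋)
open import Relation.Binary.PropositionalEquality using (_≡_; _≢_; refl; sym; cong)
open import Function.Bundles using (_⇔_)

record Graph (n : ℕ) : Set where
  field
    adj  : Fin n → Fin n → Bool
    adj-sym : ∀ i j → adj i j ≡ adj j i
    adj-irr : ∀ i → adj i i ≡ false
open Graph public

Edge : ∀ {n} → Graph n → Fin n → Fin n → Set
Edge G i j = adj G i j ≡ true

_==_ : ∀ {n} → Fin n → Fin n → Bool
i == j = ⌊ i ≟ j ⌋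

==-refl : ∀ {n} (i : Fin n) → (i == i) ≡ true
==-refl i with i ≟ i
... | yes _ = refl
... | no ¬p = contradiction refl ¬p

==-sym : ∀ {n} (i j : Fin n) → (i == j) ≡ (j == i)
==-sym i j with i ≟ j | j ≟ i
... | yes _ | yes _ = refl
... | no _  | no _  = refl
... | yes p | no ¬q = contradiction (sym p) ¬q
... | no ¬p | yes q = contradiction (sym q) ¬p

mkGraph : ∀ {n} → (Fin n → Fin n → Bool) → Graph n
mkGraph e = record
  { adj = λ i j → not (i == j) ∧ (e i j ∨ e j i)
  ; adj-sym = λ i j → sym' i j
  ; adj-irr = λ i → irr' i }
  where
  sym' : ∀ i j → (not (i == j) ∧ (e i j ∨ e j i)) ≡ (not (j == i) ∧ (e j i ∨ e i j))
  sym' i j rewrite ==-sym i j | ∨-comm (e i j) (e j i) = refl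
  irr' : ∀ i → (not (i == i) ∧ (e i i ∨ e i i)) ≡ false
  irr' i rewrite ==-refl i = refl

K : (n : ℕ) → Graph n
K n = mkGraph (λ _ _ → true)

-- W_6 on Fin 7: vertex 0 is the hub, vertices 1,…,6 form the 6-cycle
-- 1-2-3-4-5-6-1.
w6e : ℕ → ℕ → Bool
w6e zero (suc _) = true
w6e (suc a) (suc b) = rim a b
  where
  -- rim vertices a+1, b+1 with a,b ∈ {0..5}: consecutive mod 6
  succ6 : ℕ → ℕ
  succ6 5 = 0
  succ6 k = suc k
  eqℕ : ℕ → ℕ → Bool
  eqℕ zero zero = true
  eqℕ (suc x) (suc y) = eqℕ x y
  eqℕ _ _ = false
  rim : ℕ → ℕ → Bool
  rim x y = eqℕ (succ6 x) y
w6e _ _ = false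

W6 : Graph 7
W6 = mkGraph (λ i j → w6e (toℕ i) (toℕ j))

Surjective : ∀ {m n} → (Fin m → Fin n) → Set
Surjective f = ∀ b → ∃ λ a → f a ≡ b

Injective : ∀ {m n} → (Fin m → Fin n) → Set
Injective f = ∀ a a' → f a ≡ f a' → a ≡ a'

SamePair : ∀ {n} → Fin n → Fin n → Fin n → Fin n → Set
SamePair i j u v = (i ≡ u × j ≡ v) ⊎ (i ≡ v × j ≡ u)

Iso : ∀ {m n} → Graph m → Graph n → Set
Iso {m} {n} G H = Σ (Fin m → Fin n) λ f →
  Injective f × Surjective f × (∀ i j → adj H (f i) (f j) ≡ adj G i j)

DeleteEdge : ∀ {m n} → Graph m → Graph n → Set
DeleteEdge {m} {n} G H = Σ (Fin m) λ u → Σ (Fin m) λ v → Edge G u v ×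
  Σ (Fin m → Fin n) λ f → Injective f × Surjective f ×
  (∀ i j → Edge H (f i) (f j) ⇔ (Edge G i j × ¬ SamePair i j u v))

-- H is (isomorphic to) G with the edge uv contracted: f identifies
-- exactly u and v; H is simple (loops and parallel edges suppressed).
ContractEdge : ∀ {m n} → Graph m → Graph n → Set
ContractEdge {m} {n} G H = Σ (Fin m) λ u → Σ (Fin m) λ v → Edge G u v ×
  Σ (Fin m → Fin n) λ f → Surjective f × f u ≡ f v ×
  (∀ i j → f i ≡ f j → i ≡ j ⊎ SamePair i j u v) ×
  (∀ a b → Edge H a b ⇔
     (a ≢ b × ∃ λ i → ∃ λ j → f i ≡ a × f j ≡ b × Edge G i j))

data _≼_ : ∀ {m n} → Graph m → Graph n → Set where
  iso  : ∀ {m n} {H : Graph m} {G : Graph n} → Iso G H → H ≼ G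
  del  : ∀ {k m n} {H : Graph k} {G' : Graph m} {G : Graph n} →
         DeleteEdge G' H → G' ≼ G → H ≼ G
  con  : ∀ {k m n} {H : Graph k} {G' : Graph m} {G : Graph n} →
         ContractEdge G' H → G' ≼ G → H ≼ G

N : ∀ {n} → Graph n → Fin n → Subset n
N G v = tabulate (adj G v)

-- split G v X Y on vertex set Fin (2 + n): 0 = x, 1 = y,
-- 2 + k = the vertex punchIn v k of G ∖ v.
splitAdj : ∀ {n} → Graph (suc n) → Fin (suc n) → Subset (suc n) → Subset (suc n)
         → Fin (suc (suc n)) → Fin (suc (suc n)) → Bool
splitAdj G v X Y zero zero = false
splitAdj G v X Y zero (suc zero) = true
splitAdj G v X Y zero (suc (suc k)) = lookup X (punchIn v k)
splitAdj G v X Y (suc zero) zero = true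
splitAdj G v X Y (suc zero) (suc zero) = false
splitAdj G v X Y (suc zero) (suc (suc k)) = lookup Y (punchIn v k)
splitAdj G v X Y (suc (suc k)) zero = lookup X (punchIn v k)
splitAdj G v X Y (suc (suc k)) (suc zero) = lookup Y (punchIn v k)
splitAdj G v X Y (suc (suc k)) (suc (suc l)) = adj G (punchIn v k) (punchIn v l)

split : ∀ {n} → Graph (suc n) → Fin (suc n) → Subset (suc n) → Subset (suc n)
      → Graph (suc (suc n))
split G v X Y = record { adj = splitAdj G v X Y ; adj-sym = s ; adj-irr = r }
  where
  s : ∀ i j → splitAdj G v X Y i j ≡ splitAdj G v X Y j i
  s zero zero = refl
  s zero (suc zero) = refl
  s zero (suc (suc k)) = refl
  s (suc zero) zero = refl
  s (suc zero) (suc zero) = refl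
  s (suc zero) (suc (suc k)) = refl
  s (suc (suc k)) zero = refl
  s (suc (suc k)) (suc zero) = refl
  s (suc (suc k)) (suc (suc l)) = adj-sym G (punchIn v k) (punchIn v l)
  r : ∀ i → splitAdj G v X Y i i ≡ false
  r zero = refl
  r (suc zero) = refl
  r (suc (suc k)) = adj-irr G (punchIn v k)

IsSplitting : ∀ {n} → Graph (suc n) → Fin (suc n) → Subset (suc n) → Subset (suc n) → Set
IsSplitting G v X Y = X ⊆ N G v × Y ⊆ N G v × X ∪ Y ≡ N G v × 3 ≤ ∣ X ∣ × 3 ≤ ∣ Y ∣

-- A split of K₆ and W₆ both have seven vertices, so it suffices to find W₆
-- as a spanning subgraph and delete the remaining edges. Since
-- |X| + |Y| ≥ 6 > 5 = |V(K₆) ∖ v|, some c lies in X ∩ Y and is adjacent to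
-- every other vertex: it is the hub. The remaining vertices carry the
-- Hamiltonian cycle x y b d e a with b ∈ Y ∖ c and a ∈ X ∖ {b, c}, the
-- other vertices of K₆ ∖ v being pairwise adjacent. Such an embedding is
-- found, for each of the finitely many splits, by searching the
-- permutations that send the rim vertices 1 and 2 of W₆ to x and y.
module Submission where

open import Defs
open import Data.Bool as Bool using (Bool; true; false; _∧_; _∨_; not)
open import Data.Bool.Properties using (∧-zeroʳ; ∧-identityʳ)
open import Data.Nat using (ℕ; zero; suc; _≤_; _≤?_)
open import Data.Fin using (Fin; zero; _≟_; #_)
open import Data.Fin.Properties using (all?; any?)
open import Data.Fin.Permutation
  using (Permutation′; _⟨$⟩ʳ_; _⟨$⟩ˡ_; inverseˡ; inverseʳ; id; insert)
open import Data.Fin.Subset using (Subset; _⊆_; _∪_; ∣_∣)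
open import Data.Fin.Subset.Properties using (_⊆?_; anySubset?)
open import Data.List
  using (List; []; _∷_; [_]; map; concatMap; filter; allFin; cartesianProduct)
open import Data.List.Membership.Propositional.Properties
  using (∈-filter⁺; ∈-cartesianProduct⁺; ∈-allFin)
open import Data.List.Relation.Unary.All as All using (All)
open import Data.List.Relation.Unary.All.Properties using (all-filter; All¬⇒¬Any)
open import Data.List.Relation.Unary.Any as Any using (Any)
open import Data.Product using (∃; _×_; _,_; proj₁; proj₂)
open import Data.Sum using (inj₁; inj₂)
import Data.Vec.Properties as Vec
open import Function using (_$_)
open import Function.Bundles using (_⇔_; mk⇔)
import Function.Properties.Equivalence as ⇔
open import Relation.Nullary using (¬_; Dec; does; yes; no; contradiction)
open import Relation.Nullary.Decidable
  using (_×-dec_; _⊎-dec_; _→-dec_; ¬?; dec-true; dec-false; does-⇔; toWitness; from-no;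
         decidable-stable)
open import Relation.Binary.PropositionalEquality using (_≡_; refl; sym; trans; cong; cong₂)

private variable
  m n : ℕ

≡true-cong : {x y : Bool} → x ≡ y → x ≡ true ⇔ y ≡ true
≡true-cong x≡y = mk⇔ (trans (sym x≡y)) (trans x≡y)

≼-resp-adj : {H H′ : Graph m} {G : Graph n} →
  (∀ a b → adj H a b ≡ adj H′ a b) → H ≼ G → H′ ≼ G
≼-resp-adj H≡H′ (iso (f , f-inj , f-surj , f-adj)) =
  iso (f , f-inj , f-surj , λ i j → trans (sym (H≡H′ (f i) (f j))) (f-adj i j))
≼-resp-adj H≡H′ (del (u , v , uv , f , f-inj , f-surj , f-edge) G′≼G) =
  del (u , v , uv , f , f-inj , f-surj ,
       λ i j → ⇔.trans (≡true-cong (sym (H≡H′ (f i) (f j)))) (f-edge i j)) G′≼G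
≼-resp-adj H≡H′ (con (u , v , uv , f , f-surj , fu≡fv , f-fibres , f-edge) G′≼G) =
  con (u , v , uv , f , f-surj , fu≡fv , f-fibres ,
       λ a b → ⇔.trans (≡true-cong (sym (H≡H′ a b))) (f-edge a b)) G′≼G

samePair? : (i j u w : Fin n) → Dec (SamePair i j u w)
samePair? i j u w = (i ≟ u ×-dec j ≟ w) ⊎-dec (i ≟ w ×-dec j ≟ u)

SamePair-swap : {i j u w : Fin n} → SamePair i j u w → SamePair j i u w
SamePair-swap (inj₁ (i≡u , j≡w)) = inj₂ (j≡w , i≡u)
SamePair-swap (inj₂ (i≡w , j≡u)) = inj₁ (j≡u , i≡w)

adj-resp-SamePair : (G : Graph n) {i j u w : Fin n} → SamePair i j u w → adj G i j ≡ adj G u w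
adj-resp-SamePair G (inj₁ (refl , refl)) = refl
adj-resp-SamePair G (inj₂ (refl , refl)) = adj-sym G _ _

PairIn : Fin n → Fin n → List (Fin n × Fin n) → Set
PairIn i j = Any (λ (u , w) → SamePair i j u w)

pairIn? : (i j : Fin n) (L : List (Fin n × Fin n)) → Dec (PairIn i j L)
pairIn? i j = Any.any? (λ (u , w) → samePair? i j u w)

infixl 30 _∖_

_∖_ : Graph n → List (Fin n × Fin n) → Graph n
G ∖ L = record
  { adj     = λ i j → adj G i j ∧ not (does (pairIn? i j L))
  ; adj-sym = λ i j → cong₂ (λ g d → g ∧ not d) (adj-sym G i j)
                        (does-⇔ (mk⇔ swap swap) (pairIn? i j L) (pairIn? j i L))
  ; adj-irr = λ i → cong (λ g → g ∧ not (does (pairIn? i i L))) (adj-irr G i) }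
  where
  swap : ∀ {i j} → PairIn i j L → PairIn j i L
  swap = Any.map SamePair-swap

adj-∖-∷ : (G : Graph n) (u w : Fin n) (L : List (Fin n × Fin n)) (i j : Fin n) →
  adj (G ∖ ((u , w) ∷ L)) i j ≡ adj (G ∖ L) i j ∧ not (does (samePair? i j u w))
adj-∖-∷ G u w L i j = de-morgan (adj G i j) (does (samePair? i j u w)) (does (pairIn? i j L))
  where
  de-morgan : ∀ g s d → g ∧ not (s ∨ d) ≡ (g ∧ not d) ∧ not s
  de-morgan false s     d     = refl
  de-morgan true  false d     = sym (∧-identityʳ (not d))
  de-morgan true  true  d     = sym (∧-zeroʳ (not d))

∧-not-does⇔ : ∀ b {A : Set} (a? : Dec A) → b ∧ not (does a?) ≡ true ⇔ (b ≡ true × ¬ A)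
∧-not-does⇔ false a?     = mk⇔ (λ ()) (λ ())
∧-not-does⇔ true  (yes a) = mk⇔ (λ ()) (λ (_ , ¬a) → contradiction a ¬a)
∧-not-does⇔ true  (no ¬a) = mk⇔ (λ _ → refl , ¬a) (λ _ → refl)

∖-∷-≼ : {G : Graph n} {K : Graph m} (u w : Fin n) (L : List (Fin n × Fin n)) →
  G ∖ L ≼ K → G ∖ ((u , w) ∷ L) ≼ K
∖-∷-≼ {G = G} u w L G∖L≼K with adj (G ∖ L) u w in adj-uw
... | true  =
  del (u , w , adj-uw , (λ i → i) , (λ _ _ i≡j → i≡j) , (λ b → b , refl) , deletes-uw) G∖L≼K
  where
  deletes-uw : ∀ i j → Edge (G ∖ ((u , w) ∷ L)) i j ⇔ (Edge (G ∖ L) i j × ¬ SamePair i j u w)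
  deletes-uw i j = ⇔.trans (≡true-cong (adj-∖-∷ G u w L i j)) (∧-not-does⇔ _ (samePair? i j u w))
... | false = ≼-resp-adj unchanged G∖L≼K
  where
  unchanged : ∀ i j → adj (G ∖ L) i j ≡ adj (G ∖ ((u , w) ∷ L)) i j
  unchanged i j = sym (trans (adj-∖-∷ G u w L i j) (kept (samePair? i j u w)))
    where
    kept : (s? : Dec (SamePair i j u w)) → adj (G ∖ L) i j ∧ not (does s?) ≡ adj (G ∖ L) i j
    kept (yes ij≡uw) = trans (∧-zeroʳ _) (sym (trans (adj-resp-SamePair (G ∖ L) ij≡uw) adj-uw))
    kept (no _)      = ∧-identityʳ _

∖-≼ : {G : Graph n} {K : Graph m} (L : List (Fin n × Fin n)) → G ≼ K → G ∖ L ≼ K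
∖-≼ []            G≼K = ≼-resp-adj (λ i j → sym (∧-identityʳ _)) G≼K
∖-≼ ((u , w) ∷ L) G≼K = ∖-∷-≼ u w L (∖-≼ L G≼K)

Edge? : (G : Graph n) (a b : Fin n) → Dec (Edge G a b)
Edge? G a b = adj G a b Bool.≟ true

_⊆ᴳ_ : Graph n → Graph n → Set
H ⊆ᴳ G = ∀ a b → Edge H a b → Edge G a b

nonEdge? : (H : Graph n) (ab : Fin n × Fin n) → Dec (¬ Edge H (proj₁ ab) (proj₂ ab))
nonEdge? H (a , b) = ¬? (Edge? H a b)

allPairs : ∀ n → List (Fin n × Fin n)
allPairs n = cartesianProduct (allFin n) (allFin n)

nonEdges : Graph n → List (Fin n × Fin n)
nonEdges {n} H = filter (nonEdge? H) (allPairs n)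

adj-∖-nonEdges : {H G : Graph n} → H ⊆ᴳ G → ∀ a b → adj (G ∖ nonEdges H) a b ≡ adj H a b
adj-∖-nonEdges {H = H} {G} H⊆G a b with adj H a b in adj-ab
... | true  =
  cong₂ (λ g d → g ∧ not d) (H⊆G a b adj-ab) (dec-false (pairIn? a b (nonEdges H)) kept)
  where
  kept : ¬ PairIn a b (nonEdges H)
  kept = All¬⇒¬Any (All.map (λ uw∉H ab≡uw → uw∉H (trans (sym (adj-resp-SamePair H ab≡uw)) adj-ab))
                            (all-filter (nonEdge? H) (allPairs _)))
... | false = trans (cong (λ d → adj G a b ∧ not d) (dec-true (pairIn? a b (nonEdges H)) removed))
                    (∧-zeroʳ _)
  where
  removed : PairIn a b (nonEdges H)
  removed = Any.map (λ { refl → inj₁ (refl , refl) })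
    (∈-filter⁺ (nonEdge? H)
               (∈-cartesianProduct⁺ (∈-allFin a) (∈-allFin b))
               (λ ab∈H → contradiction (trans (sym adj-ab) ab∈H) λ ()))

⊆ᴳ⇒≼ : {H G : Graph n} {K : Graph m} → H ⊆ᴳ G → G ≼ K → H ≼ K
⊆ᴳ⇒≼ {H = H} {G} H⊆G G≼K =
  ≼-resp-adj {H = G ∖ nonEdges H} (adj-∖-nonEdges {H = H} {G} H⊆G) (∖-≼ (nonEdges H) G≼K)

comap : Permutation′ n → Graph n → Graph n
comap π G = record
  { adj     = λ a b → adj G (π ⟨$⟩ʳ a) (π ⟨$⟩ʳ b)
  ; adj-sym = λ a b → adj-sym G (π ⟨$⟩ʳ a) (π ⟨$⟩ʳ b)
  ; adj-irr = λ a → adj-irr G (π ⟨$⟩ʳ a) }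

comap-≼ : (π : Permutation′ n) (G : Graph n) → comap π G ≼ G
comap-≼ π G =
  iso ((π ⟨$⟩ˡ_) , injective , surjective , λ i j → cong₂ (adj G) (inverseʳ π) (inverseʳ π))
  where
  injective : Injective (π ⟨$⟩ˡ_)
  injective a a′ eq = trans (sym (inverseʳ π)) (trans (cong (π ⟨$⟩ʳ_) eq) (inverseʳ π))
  surjective : Surjective (π ⟨$⟩ˡ_)
  surjective b = π ⟨$⟩ʳ b , inverseˡ π

⊆ᴳ-comap⇒≼ : {H G : Graph n} (π : Permutation′ n) → H ⊆ᴳ comap π G → H ≼ G
⊆ᴳ-comap⇒≼ {G = G} π H⊆πG = ⊆ᴳ⇒≼ H⊆πG (comap-≼ π G)

AllEdges : Graph n → List (Fin n × Fin n) → Set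
AllEdges G = All (λ (u , w) → Edge G u w)

allEdges? : (G : Graph n) (E : List (Fin n × Fin n)) → Dec (AllEdges G E)
allEdges? G = All.all? (λ (u , w) → Edge? G u w)

⊆ᴳ-from-edge-list : {H G : Graph n} (E : List (Fin n × Fin n)) →
  (∀ a b → Edge H a b → PairIn a b E) → AllEdges G E → H ⊆ᴳ G
⊆ᴳ-from-edge-list {G = G} E E-complete E⊆G a b ab∈H =
  All.lookupWith (λ uw∈G ab≡uw → trans (adj-resp-SamePair G ab≡uw) uw∈G) E⊆G (E-complete a b ab∈H)

W6-edges : List (Fin 7 × Fin 7)
W6-edges =
  (# 0 , # 1) ∷ (# 0 , # 2) ∷ (# 0 , # 3) ∷ (# 0 , # 4) ∷ (# 0 , # 5) ∷ (# 0 , # 6) ∷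
  (# 1 , # 2) ∷ (# 2 , # 3) ∷ (# 3 , # 4) ∷ (# 4 , # 5) ∷ (# 5 , # 6) ∷ (# 6 , # 1) ∷ []

W6-edges-complete : ∀ a b → Edge W6 a b → PairIn a b W6-edges
W6-edges-complete =
  toWitness {a? = all? λ a → all? λ b → Edge? W6 a b →-dec pairIn? a b W6-edges} _

permutations : ∀ n → List (Permutation′ n)
permutations zero    = [ id ]
permutations (suc n) = concatMap (λ j → map (insert zero j) (permutations n)) (allFin (suc n))

-- Vertices 0 and 1 of a split are x and y; inserting 1 ↦ 0 twice sends the
-- rim vertices 1 and 2 of W₆ to them.
xy-rim-labellings : List (Permutation′ 7)
xy-rim-labellings = map (λ τ → insert (# 1) (# 0) (insert (# 1) (# 0) τ)) (permutations 5)

W6-labelling : Graph 7 → Set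
W6-labelling G = Any (λ π → AllEdges (comap π G) W6-edges) xy-rim-labellings

W6-labelling? : (G : Graph 7) → Dec (W6-labelling G)
W6-labelling? G = Any.any? (λ π → allEdges? (comap π G) W6-edges) xy-rim-labellings

W6-labelling⇒≼ : (G : Graph 7) → W6-labelling G → W6 ≼ G
W6-labelling⇒≼ G labelling =
  let π , W6⊆πG = Any.satisfied labelling
  in ⊆ᴳ-comap⇒≼ π (⊆ᴳ-from-edge-list {H = W6} {G = comap π G} W6-edges W6-edges-complete W6⊆πG)

isSplitting? : (v : Fin 6) (X Y : Subset 6) → Dec (IsSplitting (K 6) v X Y)
isSplitting? v X Y =
  X ⊆? N (K 6) v ×-dec Y ⊆? N (K 6) v ×-dec Vec.≡-dec Bool._≟_ (X ∪ Y) (N (K 6) v) ×-dec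
  3 ≤? ∣ X ∣ ×-dec 3 ≤? ∣ Y ∣

-- The conditions on X alone are repeated only to prune the search over Y.
no-split-of-K6-lacks-W6-labelling :
  ¬ ∃ λ v → ∃ λ X → (X ⊆ N (K 6) v × 3 ≤ ∣ X ∣) × ∃ λ Y →
      IsSplitting (K 6) v X Y × ¬ W6-labelling (split (K 6) v X Y)
no-split-of-K6-lacks-W6-labelling = from-no $
  any? λ v → anySubset? λ X → (X ⊆? N (K 6) v ×-dec 3 ≤? ∣ X ∣) ×-dec anySubset? λ Y →
  isSplitting? v X Y ×-dec ¬? (W6-labelling? (split (K 6) v X Y))

splits-of-K6-have-W6-labelling : ∀ v X Y → IsSplitting (K 6) v X Y →
  W6-labelling (split (K 6) v X Y)
splits-of-K6-have-W6-labelling v X Y s@(X⊆Nv , _ , _ , 3≤∣X∣ , _) =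
  decidable-stable (W6-labelling? (split (K 6) v X Y))
    λ none → no-split-of-K6-lacks-W6-labelling (v , X , (X⊆Nv , 3≤∣X∣) , Y , s , none)

lemma4p6 : (v : Fin 6) (X Y : Subset 6) → IsSplitting (K 6) v X Y →
    W6 ≼ split (K 6) v X Y
lemma4p6 v X Y s = W6-labelling⇒≼ (split (K 6) v X Y) (splits-of-K6-have-W6-labelling v X Y s)
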